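{- Let $s$ be a string with Lyndon runs $F_1,\dots,F_m$, let $d\ge1$ and $1\le i\le m-d+1$. Then the substring of $s$ associated with $\mathrm{dom}_d(F_i)$, namely the leftmost occurrence of $F_i\cdots F_{i+d-1}$ in $s$, contains an LZ77 phrase boundary.
   Context: Let $s=f_1^{e_1}\cdots f_m^{e_m}$ be the Lyndon factorization of $s$ (each $f_i$ a Lyndon word, i.e. a nonempty string strictly lexicographically smaller than all its nonempty proper suffixes; $e_i\ge1$; $f_i\succ f_{i+1}$ lexicographically) and $F_i=f_i^{e_i}$ the Lyndon runs. For $d\ge1$, $1\le i\le m-d+1$, the substring associated with the domain $\mathrm{dom}_d(F_i)$ is the leftmost occurrence of $F_i\cdots F_{i+d-1}$ in $s$. The non-overlapping LZ factorization $s=p_1\cdots p_z$ is built greedily left to right: each phrase $p_t$ is either the leftmost occurrence of a letter in $s$, or the longest prefix of $p_t\cdots p_z$ occurring as a substring of $p_1\cdots p_{t-1}$. A substring $s[a..b]$ contains an LZ77 phrase boundary if some phrase $p_t$ begins at one of the positions $a,\dots,b$. -}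

module Defs where

open import Data.Nat using (ℕ; zero; suc; _+_; _<_; _≤_)
open import Data.List using (List; []; _∷_; _++_; length; take; drop; concat; replicate; lookup)
open import Data.List.Membership.Propositional using (_∈_)
open import Data.List.Relation.Unary.Linked using (Linked)
open import Data.Product using (Σ; ∃; _×_; _,_; proj₁; proj₂)
open import Data.Sum using (_⊎_)
open import Data.Unit using (⊤)
open import Relation.Binary.PropositionalEquality using (_≡_; _≢_)
open import Relation.Nullary using (¬_)

Str : Set
Str = List ℕ

data _<lex_ : Str → Str → Set where
  []<∷  : ∀ {y ys} → [] <lex (y ∷ ys)
  head< : ∀ {x y xs ys} → x < y → (x ∷ xs) <lex (y ∷ ys)
  tail< : ∀ {x xs ys} → xs <lex ys → (x ∷ xs) <lex (x ∷ ys)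

IsLyndon : Str → Set
IsLyndon w = (w ≢ []) × (∀ k → 0 < k → k < length w → w <lex drop k w)

OccursAt : Str → Str → ℕ → Set
OccursAt w s a = take (length w) (drop a s) ≡ w

Occurs : Str → Str → Set
Occurs w s = ∃ λ a → OccursAt w s a

LeftmostOcc : Str → Str → ℕ → Set
LeftmostOcc w s a = OccursAt w s a × (∀ a' → a' < a → ¬ OccursAt w s a')

Run : (Str × ℕ) → Str
Run (f , e) = concat (replicate e f)

IsLyndonFactorization : Str → List (Str × ℕ) → Set
IsLyndonFactorization s fs =
  (∀ {fe} → fe ∈ fs → IsLyndon (proj₁ fe) × 1 ≤ proj₂ fe)
  × Linked (λ p q → proj₁ q <lex proj₁ p) fs
  × concat (Data.List.map Run fs) ≡ s

-- Lyndon runs F_i = f_i^{e_i} (0-indexed)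
runs : List (Str × ℕ) → List Str
runs fs = Data.List.map Run fs

-- Greedy condition for phrase p given already-processed text P and remaining text R = p ⋯ p_z.
GreedyPhrase : Str → Str → Str → Set
GreedyPhrase P R p =
  (∃ λ c → p ≡ c ∷ [] × ¬ (c ∈ P))
  ⊎ ((p ≢ []) × (∃ λ rest → R ≡ p ++ rest) × Occurs p P
     × (∀ k → length p < k → k ≤ length R → ¬ Occurs (take k R) P))

-- Non-overlapping LZ factorization, P is the text before the first listed phrase.
LZFrom : Str → List Str → Set
LZFrom P [] = ⊤
LZFrom P (p ∷ ps) = GreedyPhrase P (p ++ concat ps) p × LZFrom (P ++ p) ps

IsLZFactorization : Str → List Str → Set
IsLZFactorization s ps = (concat ps ≡ s) × LZFrom [] ps

starts : ℕ → List Str → List ℕ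
starts n [] = []
starts n (p ∷ ps) = n ∷ starts (n + length p) ps

ContainsBoundary : List Str → ℕ → ℕ → Set
ContainsBoundary ps a len = ∃ λ b → b ∈ starts 0 ps × a ≤ b × b < a + len

-- A phrase of the non-overlapping LZ factorization that copies from earlier text also gives an
-- earlier occurrence of every factor lying strictly inside it (past its first position), and a
-- fresh-letter phrase has no such factors. So a leftmost occurrence of a nonempty string either
-- starts exactly at a phrase start or crosses the end of the phrase it starts in; in both cases
-- it contains a phrase boundary. The Lyndon structure is only needed to see that the string
-- F_i ⋯ F_{i+d-1} is nonempty.
module Submission where

open import Defs
open import Data.Nat using (ℕ; zero; suc; _+_; _∸_; _⊓_; _≤_; _<_; z≤n; s≤s; _≤?_)
open import Data.Nat.Properties
open import Data.List using (List; []; _∷_; _++_; concat; take; drop; length)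
open import Data.List.Properties
  using (length-++; length-++-≤ˡ; ++-identityʳ; ++-assoc; length-take; length-drop; take-drop; drop-drop; take++drop≡id)
open import Data.List.Membership.Propositional using (_∈_)
open import Data.List.Relation.Unary.Any using (here; there)
open import Data.Product using (_×_; _,_; ∃; uncurry)
open import Data.Sum using (inj₁; inj₂)
open import Data.Empty using (⊥-elim)
open import Relation.Nullary using (yes; no)
open import Function using (_∘_)
open import Relation.Binary.PropositionalEquality

private variable
  w u v xs ys P R p : Str
  a c k : ℕ

take-++ˡ : ∀ {A : Set} n (xs ys : List A) → n ≤ length xs → take n (xs ++ ys) ≡ take n xs
take-++ˡ zero    xs       ys _         = refl
take-++ˡ (suc n) (x ∷ xs) ys (s≤s n≤) = cong (x ∷_) (take-++ˡ n xs ys n≤)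

take-drop-++ˡ : ∀ {A : Set} (xs ys : List A) k n → k + n ≤ length xs →
                take n (drop k (xs ++ ys)) ≡ take n (drop k xs)
take-drop-++ˡ xs ys k n k+n≤ = begin
  take n (drop k (xs ++ ys))        ≡⟨ take-drop n k (xs ++ ys) ⟩
  drop k (take (k + n) (xs ++ ys))  ≡⟨ cong (drop k) (take-++ˡ (k + n) xs ys k+n≤) ⟩
  drop k (take (k + n) xs)          ≡⟨ take-drop n k xs ⟨
  take n (drop k xs)                ∎
  where open ≡-Reasoning

drop-++-length : ∀ {A : Set} (xs ys : List A) k → drop (length xs + k) (xs ++ ys) ≡ drop k ys
drop-++-length []       ys k = refl
drop-++-length (x ∷ xs) ys k = drop-++-length xs ys k

occursAt-length : OccursAt w v a → length w ≤ length v ∸ a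
occursAt-length {w} {v} {a} occ = m⊓n≡m⇒m≤n (begin
  length w ⊓ (length v ∸ a)            ≡⟨ cong (length w ⊓_) (length-drop a v) ⟨
  length w ⊓ length (drop a v)         ≡⟨ length-take (length w) (drop a v) ⟨
  length (take (length w) (drop a v))  ≡⟨ cong length occ ⟩
  length w                             ∎)
  where open ≡-Reasoning

-- An empty w occurs at every position, even beyond the end of v.
occursAt-end≤length : OccursAt w v a → 0 < length w → a + length w ≤ length v
occursAt-end≤length {w} {v} {a} occ 0<w =
  subst (_≤ length v) (+-comm (length w) a) (m≤o∸n⇒m+n≤o (length w) (<⇒≤ a<v) w≤)
  where
  w≤ : length w ≤ length v ∸ a
  w≤ = occursAt-length {w} {v} {a} occ
  a<v : a < length v
  a<v = m∸n≢0⇒n<m (n>0⇒n≢0 (≤-trans 0<w w≤))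

occursAt-++⁺ˡ : k + length w ≤ length xs → OccursAt w xs k → OccursAt w (xs ++ ys) k
occursAt-++⁺ˡ {k} {w} {xs} {ys} end≤ occ = trans (take-drop-++ˡ xs ys k (length w) end≤) occ

occursAt-++⁻ˡ : k + length w ≤ length xs → OccursAt w (xs ++ ys) k → OccursAt w xs k
occursAt-++⁻ˡ {k} {w} {xs} {ys} end≤ occ = trans (sym (take-drop-++ˡ xs ys k (length w) end≤)) occ

occursAt-++⁻ʳ : OccursAt w (xs ++ ys) (length xs + k) → OccursAt w ys k
occursAt-++⁻ʳ {w} {xs} {ys} {k} occ =
  trans (cong (take (length w)) (sym (drop-++-length xs ys k))) occ

occursAt-trans : k + length w ≤ length u → OccursAt w u k → OccursAt u v c → OccursAt w v (c + k)
occursAt-trans {k} {w} {u} {v} {c} end≤ w-in-u u-in-v = begin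
  take (length w) (drop (c + k) v)                        ≡⟨ cong (take (length w)) (drop-drop c k v) ⟨
  take (length w) (drop k (drop c v))                     ≡⟨ cong (take (length w) ∘ drop k) (take++drop≡id (length u) (drop c v)) ⟨
  take (length w) (drop k (take (length u) (drop c v) ++ rest)) ≡⟨ cong (λ t → take (length w) (drop k (t ++ rest))) u-in-v ⟩
  take (length w) (drop k (u ++ rest))                    ≡⟨ take-drop-++ˡ u rest k (length w) end≤ ⟩
  take (length w) (drop k u)                              ≡⟨ w-in-u ⟩
  w                                                       ∎
  where
  open ≡-Reasoning
  rest : Str
  rest = drop (length u) (drop c v)

greedyPhrase-interior-occursEarlier :
  GreedyPhrase P R p → 0 < length w → 0 < k → k + length w ≤ length p →
  OccursAt w (P ++ R) (length P + k) → ∃ λ a → a < length P + k × OccursAt w (P ++ R) a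
greedyPhrase-interior-occursEarlier (inj₁ (_ , refl , _)) 0<w 0<k inside _ =
  ⊥-elim (<-irrefl refl (≤-trans (+-mono-≤ 0<k 0<w) inside))
greedyPhrase-interior-occursEarlier {P} {p = p} {w} {k}
    (inj₂ (_ , (rest , refl) , (c , p-in-P) , _)) 0<w 0<k inside occ =
  c + k , +-monoˡ-< k c<P , occursAt-++⁺ˡ {xs = P} end≤P (occursAt-trans {v = P} {c} inside w-in-p p-in-P)
  where
  w-in-p : OccursAt w p k
  w-in-p = occursAt-++⁻ˡ inside (occursAt-++⁻ʳ {xs = P} occ)
  p-end≤P : c + length p ≤ length P
  p-end≤P = occursAt-end≤length {p} {P} {c} p-in-P (≤-trans 0<k (m+n≤o⇒m≤o k inside))
  c<P : c < length P
  c<P = <-≤-trans (m<m+n c (≤-trans 0<k (m+n≤o⇒m≤o k inside))) p-end≤P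
  end≤P : c + k + length w ≤ length P
  end≤P = ≤-trans (≤-reflexive (+-assoc c k (length w))) (≤-trans (+-monoʳ-≤ c inside) p-end≤P)

BoundaryIn : List ℕ → ℕ → ℕ → Set
BoundaryIn bs a len = ∃ λ b → b ∈ bs × a ≤ b × b < a + len

second-start-∈ : ∀ n p ps → n + length p < n + length (concat (p ∷ ps)) →
                 n + length p ∈ starts n (p ∷ ps)
second-start-∈ n p []      p<p++[] =
  ⊥-elim (<-irrefl (cong (n +_) (sym (trans (length-++ p) (+-identityʳ _)))) p<p++[])
second-start-∈ n p (_ ∷ _) _ = there (here refl)

leftmostOcc-boundaryIn-starts : ∀ P ps → LZFrom P ps → LeftmostOcc w (P ++ concat ps) a →
  0 < length w → length P ≤ a → BoundaryIn (starts (length P) ps) a (length w)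
leftmostOcc-boundaryIn-starts {w} {a} P [] _ (occ , _) 0<w P≤a = ⊥-elim (begin-contradiction
  a                 <⟨ m<m+n a 0<w ⟩
  a + length w      ≤⟨ occursAt-end≤length occ 0<w ⟩
  length (P ++ [])  ≡⟨ cong length (++-identityʳ P) ⟩
  length P          ≤⟨ P≤a ⟩
  a                 ∎)
  where open ≤-Reasoning
leftmostOcc-boundaryIn-starts {a = a} P (p ∷ ps) (greedy , lz) lo 0<w P≤a
  with length P + length p ≤? a
... | yes Pp≤a
  with leftmostOcc-boundaryIn-starts (P ++ p) ps lz
         (subst (λ t → LeftmostOcc _ t _) (sym (++-assoc P p (concat ps))) lo) 0<w
         (subst (_≤ _) (sym (length-++ P)) Pp≤a)
...   | b , b∈ , a≤b , b<end = b , there (subst (λ n → b ∈ starts n ps) (length-++ P) b∈) , a≤b , b<end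
leftmostOcc-boundaryIn-starts {w} P (p ∷ ps) (greedy , lz) (occ , leftmost) 0<w P≤a | no a<Pp
  with m≤n⇒∃[o]m+o≡n P≤a
... | zero  , refl = length P + 0 , here (+-identityʳ (length P)) , ≤-refl , m<m+n _ 0<w
... | suc k , refl with suc k + length w ≤? length p
...   | yes inside
  with greedyPhrase-interior-occursEarlier greedy 0<w (s≤s z≤n) inside occ
...     | a′ , a′<a , occ′ = ⊥-elim (leftmost a′ a′<a occ′)
leftmostOcc-boundaryIn-starts {w} P (p ∷ ps) (greedy , lz) (occ , leftmost) 0<w P≤a
  | no a<Pp | suc k , refl | no crosses =
  length P + length p , second-start-∈ (length P) p ps (<-≤-trans Pp<end end≤) ,
  <⇒≤ (≰⇒> a<Pp) , Pp<end
  where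
  Pp<end : length P + length p < length P + suc k + length w
  Pp<end = subst (length P + length p <_) (sym (+-assoc (length P) (suc k) (length w)))
                 (+-monoʳ-< (length P) (≰⇒> crosses))
  end≤ : length P + suc k + length w ≤ length P + length (concat (p ∷ ps))
  end≤ = ≤-trans (occursAt-end≤length occ 0<w) (≤-reflexive (length-++ P))

run-nonempty : ∀ {f e} → IsLyndon f → 1 ≤ e → 0 < length (Run (f , e))
run-nonempty {[]}    {_}     (f≢[] , _) _ = ⊥-elim (f≢[] refl)
run-nonempty {x ∷ f} {suc e} _          _ = ≤-trans (s≤s z≤n) (length-++-≤ˡ (x ∷ f))

runWindow-nonempty : ∀ (fs : List (Str × ℕ)) → (∀ {fe} → fe ∈ fs → 0 < length (Run fe)) →
                     ∀ d i → 1 ≤ d → i + d ≤ length fs → 0 < length (concat (take d (drop i (runs fs))))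
runWindow-nonempty (fe ∷ fs) runs>0 (suc d) zero    _   _          =
  ≤-trans (runs>0 (here refl)) (length-++-≤ˡ (Run fe))
runWindow-nonempty (fe ∷ fs) runs>0 d       (suc i) 1≤d (s≤s i+d≤) =
  runWindow-nonempty fs (runs>0 ∘ there) d i 1≤d i+d≤

lemma5 : (s : Str) (fs : List (Str × ℕ)) (ps : List Str) →
         IsLyndonFactorization s fs → IsLZFactorization s ps →
         (d i : ℕ) → 1 ≤ d → i + d ≤ length fs →
         (a : ℕ) → LeftmostOcc (concat (take d (drop i (runs fs)))) s a →
         ContainsBoundary ps a (length (concat (take d (drop i (runs fs)))))
lemma5 s fs ps (runs-lyndon , _ , _) (concat≡s , lz) d i 1≤d i+d≤ a leftmost =
  leftmostOcc-boundaryIn-starts [] ps lz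
    (subst (λ t → LeftmostOcc _ t a) (sym concat≡s) leftmost)
    (runWindow-nonempty fs (uncurry run-nonempty ∘ runs-lyndon) d i 1≤d i+d≤)
    z≤n
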